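{- If $G$ is any graph, then $d_g(G\circ K_1)=1$ and $d_g'(G\circ K_1)=2$.
   Context: All graphs are finite and simple. The corona $G\circ K_1$ is the graph obtained from $G$ by adding, for each vertex $v$ of $G$, a new vertex of degree $1$ adjacent to $v$. For a vertex $x$, $N[x]$ denotes its closed neighborhood. The domatic number game on a graph $H$ with palette $[k]=\{1,\dots,k\}$: two players, Alice and Bob, alternately choose a previously unchosen vertex of $H$ and assign it a color from $[k]$, until every vertex has been colored. Let $V_i$ be the set of vertices colored $i$. Alice wins if every $V_i$ ($i\in[k]$) is a dominating set of $H$, i.e. for every vertex $x$ and every color $c\in[k]$ some vertex of $N[x]$ has color $c$; otherwise Bob wins. In the $A$-game Alice moves first; in the $B$-game Bob moves first. The game domatic number $d_g(H)$ is the largest $k$ for which Alice has a winning strategy in the $A$-game with palette $[k]$, and the delayed game domatic number $d_g'(H)$ is the largest $k$ for which Alice has a winning strategy in the $B$-game with palette $[k]$. -}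

module Defs where

open import Data.Nat using (ℕ; _+_; _≤_; _<_)
open import Data.Fin using (Fin; splitAt; _≟_)
open import Data.Bool using (Bool; true; false; if_then_else_; T)
open import Data.Maybe using (Maybe; just; nothing)
open import Data.Product using (Σ; ∃; _×_; _,_)
open import Data.Sum using (_⊎_; inj₁; inj₂)
open import Relation.Nullary using (¬_; does)
open import Relation.Binary.PropositionalEquality using (_≡_)

record Graph (n : ℕ) : Set where
  field
    adj    : Fin n → Fin n → Bool
    sym    : ∀ u v → adj u v ≡ adj v u
    irrefl : ∀ v → adj v v ≡ false
open Graph public

-- Adjacency of the corona G ∘ K₁ on vertex set Fin (n + n):
-- vertices  inject₁ v  (v : Fin n) are the original vertices of G,
-- vertices  raise n v  are the new leaves, the leaf of v adjacent only to v.
coronaAdj : ∀ {n} → Graph n → Fin (n + n) → Fin (n + n) → Bool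
coronaAdj {n} G x y with splitAt n x | splitAt n y
... | inj₁ a | inj₁ b = adj G a b
... | inj₁ a | inj₂ b = does (a ≟ b)
... | inj₂ a | inj₁ b = does (a ≟ b)
... | inj₂ a | inj₂ b = false

-- Partial colorings with palette [k] = Fin k (nothing = not yet colored).
Coloring : ℕ → ℕ → Set
Coloring N k = Fin N → Maybe (Fin k)

update : ∀ {N k} → Coloring N k → Fin N → Fin k → Coloring N k
update f v c w = if does (w ≟ v) then just c else f w

Full : ∀ {N k} → Coloring N k → Set
Full {N} f = ∀ (v : Fin N) → ∃ λ c → f v ≡ just c

-- Every color class is a dominating set of the graph with adjacency A:
-- each closed neighbourhood N[x] contains a vertex of every color.
AllDominating : ∀ {N k} → (Fin N → Fin N → Bool) → Coloring N k → Set
AllDominating {N} {k} A f =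
  ∀ (x : Fin N) (c : Fin k) → ∃ λ y → (y ≡ x ⊎ T (A x y)) × f y ≡ just c

data Player : Set where
  alice bob : Player

-- AliceWins A k f p: from position f with player p to move, Alice has a
-- winning strategy in the domatic number game on the graph with adjacency A,
-- palette [k]. (Inductive, i.e. the game tree is won in finitely many moves;
-- the game is finite.)
data AliceWins {N : ℕ} (A : Fin N → Fin N → Bool) (k : ℕ)
       : Coloring N k → Player → Set where
  finished : ∀ {f p} → Full f → AllDominating A f → AliceWins A k f p
  aliceMove : ∀ {f} (v : Fin N) (c : Fin k) → f v ≡ nothing →
              AliceWins A k (update f v c) bob → AliceWins A k f alice
  bobMove : ∀ {f} → ¬ Full f →
            (∀ (v : Fin N) (c : Fin k) → f v ≡ nothing →
               AliceWins A k (update f v c) alice) →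
            AliceWins A k f bob

empty : ∀ {N k} → Coloring N k
empty _ = nothing

AliceWinsAGame AliceWinsBGame : ∀ {N} → (Fin N → Fin N → Bool) → ℕ → Set
AliceWinsAGame A k = AliceWins A k empty alice
AliceWinsBGame A k = AliceWins A k empty bob

GameDomaticNumberIs : ∀ {N} → (Fin N → Fin N → Bool) → ℕ → Set
GameDomaticNumberIs A m =
  AliceWinsAGame A m × (∀ k → m < k → ¬ AliceWinsAGame A k)

DelayedGameDomaticNumberIs : ∀ {N} → (Fin N → Fin N → Bool) → ℕ → Set
DelayedGameDomaticNumberIs A m =
  AliceWinsBGame A m × (∀ k → m < k → ¬ AliceWinsBGame A k)

-- Every leaf of G ∘ K₁ has closed neighbourhood {leaf, support vertex}, so a colouring all of whose
-- classes dominate uses at most two colours and gives the two vertices of each such pair different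
-- colours. Hence Alice cannot win with three colours, and with two colours in the A-game Bob copies
-- Alice's first colour onto the partner of her vertex. Conversely the leaf–support pairs form a
-- perfect matching: in the B-game Alice answers each move of Bob on the partner vertex with the
-- other colour, after which every vertex sees both colours. With one colour every full colouring
-- is dominating.
module Submission where

open import Defs hiding (sym)
open import Data.Nat using (ℕ; zero; suc; _+_; _<_; _≤_; s≤s)
open import Data.Fin using (Fin; zero; suc; splitAt; join; opposite; _↑ˡ_; _↑ʳ_; _≟_)
open import Data.Fin.Properties using (splitAt-join; join-splitAt; splitAt-↑ʳ; splitAt⁻¹-↑ˡ; splitAt⁻¹-↑ʳ; any?)
open import Data.Fin.Subset using (Subset; _∈_; _∉_; _⊂_)
open import Data.Fin.Subset.Properties using (⊂-trans)
open import Data.Fin.Subset.Induction using (Acc; acc; ⊂-wellFounded)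
open import Data.Vec using (tabulate)
open import Data.Vec.Properties using (lookup∘tabulate; lookup⇒[]=; []=⇒lookup)
open import Data.Bool using (Bool; true; T)
open import Data.Maybe using (Maybe; just; nothing; is-nothing)
open import Data.Maybe.Properties using (just-injective; ≡-dec)
open import Data.Product using (∃; ∃₂; _×_; _,_)
open import Data.Sum using (_⊎_; inj₁; inj₂; swap)
open import Data.Sum.Properties using (swap-involutive)
open import Data.Unit using (⊤; tt)
open import Data.Empty using (⊥-elim)
open import Function using (_∘_)
open import Relation.Nullary using (¬_; Dec; yes; no; contradiction)
open import Relation.Nullary.Decidable using (dec-true; dec-false)
open import Relation.Binary.PropositionalEquality

InClosedNbhd : ∀ {N} → (Fin N → Fin N → Bool) → Fin N → Fin N → Set
InClosedNbhd A x y = y ≡ x ⊎ T (A x y)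

module _ {N k : ℕ} where

  update-same : ∀ (f : Coloring N k) v c → update f v c v ≡ just c
  update-same f v c rewrite dec-true (v ≟ v) refl = refl

  update-other : ∀ (f : Coloring N k) {v w} c → w ≢ v → update f v c w ≡ f w
  update-other f {v} {w} c w≢v rewrite dec-false (w ≟ v) w≢v = refl

  colored≢uncolored : ∀ {f : Coloring N k} {x v c} → f x ≡ just c → f v ≡ nothing → x ≢ v
  colored≢uncolored fx fv refl with () ← trans (sym fx) fv

  uncolored⇒¬Full : ∀ {f : Coloring N k} {v} → f v ≡ nothing → ¬ Full f
  uncolored⇒¬Full {f} {v} fv full =
    let (_ , fv≡c) = full v in colored≢uncolored {f = f} fv≡c fv refl

  full-or-uncolored : ∀ (f : Coloring N k) → Full f ⊎ ∃ λ v → f v ≡ nothing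
  full-or-uncolored f with any? (λ v → ≡-dec _≟_ (f v) nothing)
  ... | yes uncolored = inj₂ uncolored
  ... | no none = inj₁ λ v → colored (f v) (λ fv → none (v , fv))
    where
    colored : ∀ m → m ≢ nothing → ∃ λ c → m ≡ just c
    colored (just c) _ = c , refl
    colored nothing m≢nothing = contradiction refl m≢nothing

  uncoloredSet : Coloring N k → Subset N
  uncoloredSet f = tabulate (is-nothing ∘ f)

  ∈-uncoloredSet⁺ : ∀ {f : Coloring N k} {v} → f v ≡ nothing → v ∈ uncoloredSet f
  ∈-uncoloredSet⁺ {f} {v} fv = lookup⇒[]= v _ (trans (lookup∘tabulate _ v) (cong is-nothing fv))

  ∈-uncoloredSet⁻ : ∀ {f : Coloring N k} {v} → v ∈ uncoloredSet f → f v ≡ nothing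
  ∈-uncoloredSet⁻ {f} {v} v∈ =
    is-nothing⇒≡nothing (f v) (trans (sym (lookup∘tabulate _ v)) ([]=⇒lookup v∈))
    where
    is-nothing⇒≡nothing : ∀ (m : Maybe (Fin k)) → is-nothing m ≡ true → m ≡ nothing
    is-nothing⇒≡nothing nothing _ = refl

  uncoloredSet-update : ∀ {f : Coloring N k} {v} c → f v ≡ nothing →
                        uncoloredSet (update f v c) ⊂ uncoloredSet f
  uncoloredSet-update {f} {v} c fv = still-uncolored , v , ∈-uncoloredSet⁺ fv , v-colored
    where
    v-colored : v ∉ uncoloredSet (update f v c)
    v-colored v∈ = colored≢uncolored {f = update f v c} (update-same f v c) (∈-uncoloredSet⁻ v∈) refl
    still-uncolored : ∀ {w} → w ∈ uncoloredSet (update f v c) → w ∈ uncoloredSet f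
    still-uncolored {w} w∈ with w ≟ v
    ... | yes refl = ⊥-elim (v-colored w∈)
    ... | no w≢v = ∈-uncoloredSet⁺ (trans (sym (update-other f c w≢v)) (∈-uncoloredSet⁻ w∈))

module _ {N k : ℕ} (A : Fin N → Fin N → Bool) where

  aliceWins-whenFullDominates : (∀ {f : Coloring N (suc k)} → Full f → AllDominating A f) →
                                ∀ f p → AliceWins A (suc k) f p
  aliceWins-whenFullDominates full⇒dominating f = play f (⊂-wellFounded (uncoloredSet f))
    where
    play : ∀ f → Acc _⊂_ (uncoloredSet f) → ∀ p → AliceWins A (suc k) f p
    play f _ p with full-or-uncolored f
    ... | inj₁ full = finished full (full⇒dominating full)
    play f (acc smaller) alice | inj₂ (v , fv) =
      aliceMove v zero fv (play _ (smaller (uncoloredSet-update zero fv)) bob)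
    play f (acc smaller) bob | inj₂ (v , fv) =
      bobMove (uncolored⇒¬Full fv) λ w c fw → play _ (smaller (uncoloredSet-update c fw)) alice

module Spoiling {N k : ℕ} (A : Fin N → Fin N → Bool) (Spoiled : Coloring N (suc k) → Set)
  (spoiled-update : ∀ {f v} c → f v ≡ nothing → Spoiled f → Spoiled (update f v c))
  (spoiled⇒¬dominating : ∀ {f} → Spoiled f → ¬ AllDominating A f) where

  spoiled⇒aliceLoses : ∀ {f p} → Spoiled f → ¬ AliceWins A (suc k) f p
  spoiled⇒aliceLoses spoiled (finished _ dominating) = spoiled⇒¬dominating spoiled dominating
  spoiled⇒aliceLoses spoiled (aliceMove v c fv rest) =
    spoiled⇒aliceLoses (spoiled-update c fv spoiled) rest
  spoiled⇒aliceLoses {f} spoiled (bobMove ¬full rest) with full-or-uncolored f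
  ... | inj₁ full = ¬full full
  ... | inj₂ (v , fv) = spoiled⇒aliceLoses (spoiled-update zero fv spoiled) (rest v zero fv)

  bobSpoils⇒aliceLoses : ∀ {f} w d → f w ≡ nothing → Spoiled (update f w d) →
                         ¬ AliceWins A (suc k) f bob
  bobSpoils⇒aliceLoses w d fw spoiled (finished full _) = uncolored⇒¬Full fw full
  bobSpoils⇒aliceLoses w d fw spoiled (bobMove _ rest) = spoiled⇒aliceLoses spoiled (rest w d fw)

full⇒allDominating₁ : ∀ {N} (A : Fin N → Fin N → Bool) {f : Coloring N 1} →
                      Full f → AllDominating A f
full⇒allDominating₁ A full x zero with full x
... | zero , fx = x , inj₁ refl , fx

CoversPalette : ∀ {k} → Maybe (Fin k) → Maybe (Fin k) → Set
CoversPalette m m′ = ∀ c → m ≡ just c ⊎ m′ ≡ just c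

dominating⇒coversPalette : ∀ {N k} {A : Fin N → Fin N → Bool} {f : Coloring N k} {ℓ u v} →
                           AllDominating A f → (∀ {y} → InClosedNbhd A ℓ y → y ≡ u ⊎ y ≡ v) →
                           CoversPalette (f u) (f v)
dominating⇒coversPalette {ℓ = ℓ} dominating N[ℓ]⊆uv c with dominating ℓ c
... | y , y∈N[ℓ] , fy with N[ℓ]⊆uv y∈N[ℓ]
...   | inj₁ refl = inj₁ fy
...   | inj₂ refl = inj₂ fy

¬coversPalette₃ : ∀ {k} (m m′ : Maybe (Fin (3 + k))) → ¬ CoversPalette m m′
¬coversPalette₃ m m′ covers with covers zero | covers (suc zero) | covers (suc (suc zero))
... | inj₁ refl | inj₁ () | _
... | inj₂ refl | inj₂ () | _
... | inj₁ refl | inj₂ refl | inj₁ ()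
... | inj₁ refl | inj₂ refl | inj₂ ()
... | inj₂ refl | inj₁ refl | inj₁ ()
... | inj₂ refl | inj₁ refl | inj₂ ()

≢opposite : ∀ (c : Fin 2) → c ≢ opposite c
≢opposite zero ()
≢opposite (suc zero) ()

monochromatic⇒¬coversPalette₂ : ∀ {m m′ : Maybe (Fin 2)} {c} → m ≡ just c → m′ ≡ just c →
                                ¬ CoversPalette m m′
monochromatic⇒¬coversPalette₂ {c = c} mc m′c covers with covers (opposite c)
... | inj₁ m≡ = ≢opposite c (just-injective (trans (sym mc) m≡))
... | inj₂ m′≡ = ≢opposite c (just-injective (trans (sym m′c) m′≡))

data ProperPair {k : ℕ} : Maybe (Fin k) → Maybe (Fin k) → Set where
  blank    : ProperPair nothing nothing
  distinct : ∀ {c d} → c ≢ d → ProperPair (just c) (just d)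

properPair⇒coversPalette₂ : ∀ {m m′ : Maybe (Fin 2)} → ProperPair m m′ → (∃ λ c → m ≡ just c) →
                            CoversPalette m m′
properPair⇒coversPalette₂ blank (_ , ())
properPair⇒coversPalette₂ (distinct {zero} {zero} c≢d) _ _ = contradiction refl c≢d
properPair⇒coversPalette₂ (distinct {suc zero} {suc zero} c≢d) _ _ = contradiction refl c≢d
properPair⇒coversPalette₂ (distinct {zero} {suc zero} _) _ zero = inj₁ refl
properPair⇒coversPalette₂ (distinct {zero} {suc zero} _) _ (suc zero) = inj₂ refl
properPair⇒coversPalette₂ (distinct {suc zero} {zero} _) _ zero = inj₂ refl
properPair⇒coversPalette₂ (distinct {suc zero} {zero} _) _ (suc zero) = inj₁ refl

module PairingStrategy {N : ℕ} (A : Fin N → Fin N → Bool) (partner : Fin N → Fin N)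
  (partner-involutive : ∀ x → partner (partner x) ≡ x)
  (partner-fixpointFree : ∀ x → partner x ≢ x)
  (adjacent-partner : ∀ x → T (A x (partner x))) where

  ProperlyPaired : Coloring N 2 → Set
  ProperlyPaired f = ∀ x → ProperPair (f x) (f (partner x))

  properlyPaired⇒partner-uncolored : ∀ {f w} → ProperlyPaired f → f w ≡ nothing →
                                     f (partner w) ≡ nothing
  properlyPaired⇒partner-uncolored {f} {w} paired fw with f w | f (partner w) | paired w
  ... | nothing | nothing | blank = refl

  properlyPaired-full⇒dominating : ∀ {f} → ProperlyPaired f → Full f → AllDominating A f
  properlyPaired-full⇒dominating paired full x e
    with properPair⇒coversPalette₂ (paired x) (full x) e
  ... | inj₁ fx = x , inj₁ refl , fx
  ... | inj₂ fpx = partner x , inj₂ (adjacent-partner x) , fpx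

  answer : Coloring N 2 → Fin N → Fin 2 → Coloring N 2
  answer f w c = update (update f w c) (partner w) (opposite c)

  answer-played : ∀ f w c → answer f w c w ≡ just c
  answer-played f w c =
    trans (update-other (update f w c) (opposite c) (partner-fixpointFree w ∘ sym)) (update-same f w c)

  answer-response : ∀ f w c → answer f w c (partner w) ≡ just (opposite c)
  answer-response f w c = update-same (update f w c) (partner w) (opposite c)

  answer-elsewhere : ∀ f {w y} c → y ≢ w → y ≢ partner w → answer f w c y ≡ f y
  answer-elsewhere f {w} c y≢w y≢pw =
    trans (update-other (update f w c) (opposite c) y≢pw) (update-other f c y≢w)

  pairedAt-answer : ∀ {f w} c → ProperlyPaired f → ∀ {x} → Dec (x ≡ w) → Dec (x ≡ partner w) →
                    ProperPair (answer f w c x) (answer f w c (partner x))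
  pairedAt-answer {f} {w} c _ (yes refl) _ =
    subst₂ ProperPair (sym (answer-played f w c)) (sym (answer-response f w c)) (distinct (≢opposite c))
  pairedAt-answer {f} {w} c _ (no _) (yes refl) =
    subst₂ ProperPair (sym (answer-response f w c)) (sym played) (distinct (≢opposite c ∘ sym))
    where
    played : answer f w c (partner (partner w)) ≡ just c
    played = trans (cong (answer f w c) (partner-involutive w)) (answer-played f w c)
  pairedAt-answer {f} {w} c paired {x} (no x≢w) (no x≢pw) =
    subst₂ ProperPair (sym (answer-elsewhere f c x≢w x≢pw)) (sym (answer-elsewhere f c px≢w px≢pw))
      (paired x)
    where
    px≢w : partner x ≢ w
    px≢w px≡w = x≢pw (trans (sym (partner-involutive x)) (cong partner px≡w))
    px≢pw : partner x ≢ partner w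
    px≢pw px≡pw =
      x≢w (trans (sym (partner-involutive x)) (trans (cong partner px≡pw) (partner-involutive w)))

  properlyPaired-answer : ∀ {f w} c → ProperlyPaired f → ProperlyPaired (answer f w c)
  properlyPaired-answer {w = w} c paired x = pairedAt-answer c paired (x ≟ w) (x ≟ partner w)

  aliceWins-BGame : AliceWinsBGame A 2
  aliceWins-BGame = respond empty (⊂-wellFounded _) (λ _ → blank)
    where
    respond : ∀ f → Acc _⊂_ (uncoloredSet f) → ProperlyPaired f → AliceWins A 2 f bob
    respond f (acc smaller) paired with full-or-uncolored f
    ... | inj₁ full = finished full (properlyPaired-full⇒dominating paired full)
    ... | inj₂ (v , fv) = bobMove (uncolored⇒¬Full fv) λ w c fw →
      let pw-uncolored = trans (update-other f c (partner-fixpointFree w))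
                               (properlyPaired⇒partner-uncolored paired fw)
      in aliceMove (partner w) (opposite c) pw-uncolored
           (respond _ (smaller (⊂-trans (uncoloredSet-update (opposite c) pw-uncolored)
                                        (uncoloredSet-update c fw)))
                    (properlyPaired-answer c paired))

module Corona {n : ℕ} (G : Graph n) where

  partner : Fin (n + n) → Fin (n + n)
  partner x = join n n (swap (splitAt n x))

  partner-involutive : ∀ x → partner (partner x) ≡ x
  partner-involutive x = begin
    join n n (swap (splitAt n (join n n (swap (splitAt n x)))))
      ≡⟨ cong (join n n ∘ swap) (splitAt-join n n (swap (splitAt n x))) ⟩
    join n n (swap (swap (splitAt n x)))
      ≡⟨ cong (join n n) (swap-involutive (splitAt n x)) ⟩
    join n n (splitAt n x)
      ≡⟨ join-splitAt n n x ⟩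
    x ∎
    where open ≡-Reasoning

  partner-fixpointFree : ∀ x → partner x ≢ x
  partner-fixpointFree x px≡x = swap-fixpointFree (splitAt n x)
    (trans (sym (splitAt-join n n (swap (splitAt n x)))) (cong (splitAt n) px≡x))
    where
    swap-fixpointFree : ∀ (s : Fin n ⊎ Fin n) → swap s ≢ s
    swap-fixpointFree (inj₁ _) ()
    swap-fixpointFree (inj₂ _) ()

  adjacent-partner : ∀ x → T (coronaAdj G x (partner x))
  adjacent-partner x rewrite splitAt-join n n (swap (splitAt n x)) with splitAt n x
  ... | inj₁ a rewrite dec-true (a ≟ a) refl = tt
  ... | inj₂ a rewrite dec-true (a ≟ a) refl = tt

  leaf-adjacent : ∀ a y → T (coronaAdj G (n ↑ʳ a) y) → y ≡ a ↑ˡ n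
  leaf-adjacent a y adj with splitAt n (n ↑ʳ a) | splitAt-↑ʳ n n a | splitAt n y in ey
  ... | _ | refl | inj₁ b with a ≟ b
  ...   | yes refl = sym (splitAt⁻¹-↑ˡ ey)

  pair⊇someClosedNbhd : ∀ x → ∃ λ ℓ → ∀ {y} → InClosedNbhd (coronaAdj G) ℓ y →
                        y ≡ x ⊎ y ≡ partner x
  pair⊇someClosedNbhd x with splitAt n x in ex
  ... | inj₁ a = n ↑ʳ a , λ where
    (inj₁ y≡ℓ) → inj₂ y≡ℓ
    (inj₂ adj) → inj₁ (trans (leaf-adjacent a _ adj) (splitAt⁻¹-↑ˡ ex))
  ... | inj₂ a = n ↑ʳ a , λ where
    (inj₁ y≡ℓ) → inj₁ (trans y≡ℓ (splitAt⁻¹-↑ʳ ex))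
    (inj₂ adj) → inj₂ (leaf-adjacent a _ adj)

  ¬dominating₃ : ∀ {k} {f : Coloring (n + n) (3 + k)} → Fin (n + n) →
                 ¬ AllDominating (coronaAdj G) f
  ¬dominating₃ {f = f} x dominating =
    let (_ , N[ℓ]⊆pair) = pair⊇someClosedNbhd x
    in ¬coversPalette₃ (f x) (f (partner x)) (dominating⇒coversPalette dominating N[ℓ]⊆pair)

  aliceLoses₃ : ∀ {k f p} → Fin (n + n) → ¬ AliceWins (coronaAdj G) (3 + k) f p
  aliceLoses₃ x = spoiled⇒aliceLoses tt
    where open Spoiling (coronaAdj G) (λ _ → ⊤) (λ _ _ _ → tt) (λ _ → ¬dominating₃ x)

  Monochromatic : Coloring (n + n) 2 → Set
  Monochromatic f = ∃₂ λ x c → f x ≡ just c × f (partner x) ≡ just c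

  monochromatic-update : ∀ {f v} c → f v ≡ nothing → Monochromatic f → Monochromatic (update f v c)
  monochromatic-update {f} c fv (x , d , fx , fpx) =
    x , d , trans (update-other f c (colored≢uncolored {f = f} fx fv)) fx
          , trans (update-other f c (colored≢uncolored {f = f} fpx fv)) fpx

  monochromatic⇒¬dominating : ∀ {f} → Monochromatic f → ¬ AllDominating (coronaAdj G) f
  monochromatic⇒¬dominating (x , c , fx , fpx) dominating =
    let (_ , N[ℓ]⊆pair) = pair⊇someClosedNbhd x
    in monochromatic⇒¬coversPalette₂ fx fpx (dominating⇒coversPalette dominating N[ℓ]⊆pair)

  aliceLoses-AGame₂ : Fin (n + n) → ¬ AliceWinsAGame (coronaAdj G) 2
  aliceLoses-AGame₂ x (finished full _) = uncolored⇒¬Full {v = x} refl full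
  aliceLoses-AGame₂ _ (aliceMove v c _ rest) =
    bobSpoils⇒aliceLoses (partner v) c (update-other empty c pv≢v)
      (v , c , trans (update-other afterAlice c (pv≢v ∘ sym)) (update-same empty v c)
             , update-same afterAlice (partner v) c)
      rest
    where
    open Spoiling (coronaAdj G) Monochromatic monochromatic-update monochromatic⇒¬dominating
    afterAlice : Coloring (n + n) 2
    afterAlice = update empty v c
    pv≢v : partner v ≢ v
    pv≢v = partner-fixpointFree v

  aliceWins-BGame₂ : AliceWinsBGame (coronaAdj G) 2
  aliceWins-BGame₂ = PairingStrategy.aliceWins-BGame (coronaAdj G) partner
                       partner-involutive partner-fixpointFree adjacent-partner

proposition3p4 : ∀ (n : ℕ) → 1 ≤ n → (G : Graph n) →
    GameDomaticNumberIs (coronaAdj G) 1 × DelayedGameDomaticNumberIs (coronaAdj G) 2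
proposition3p4 zero () G
proposition3p4 (suc m) _ G =
    ( aliceWins-whenFullDominates (coronaAdj G) (full⇒allDominating₁ (coronaAdj G)) empty alice
    , ¬AGame )
  , (aliceWins-BGame₂ , ¬BGame)
  where
  open Corona G
  ¬AGame : ∀ k → 1 < k → ¬ AliceWinsAGame (coronaAdj G) k
  ¬AGame (suc zero) (s≤s ())
  ¬AGame (suc (suc zero)) _ = aliceLoses-AGame₂ zero
  ¬AGame (suc (suc (suc k))) _ = aliceLoses₃ zero
  ¬BGame : ∀ k → 2 < k → ¬ AliceWinsBGame (coronaAdj G) k
  ¬BGame (suc zero) (s≤s ())
  ¬BGame (suc (suc zero)) (s≤s (s≤s ()))
  ¬BGame (suc (suc (suc k))) _ = aliceLoses₃ zero
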